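{- Let $(G,*)$ be a groupoid satisfying the identities (i) $(xy)z\approx(xz)y$, (ii) $x(yz)\approx x(zy)\approx y(xz)$, (iii) $w(x(yz))\approx w((xy)z)$. Then $s_n(*)\le2$ and $s^{ac}_n(*)\le n+1$ for $n=3,4,\dots$; if the second inequality holds as an equality then so does the first. Both equalities hold for the 3-element groupoids $\mathrm{SC}7$ (rows $0{:}\ 0\,0\,0$; $1{:}\ 0\,0\,0$; $2{:}\ 0\,2\,0$) and $\mathrm{SC}28$ (rows $0{:}\ 0\,0\,0$; $1{:}\ 0\,0\,1$; $2{:}\ 0\,0\,1$).
   Context: A groupoid $(G,*)$ is a set with a binary operation; $xy$ denotes $x*y$. $\mathcal B_n$ is the set of bracketings of the word $x_1x_2\cdots x_n$ (all ways to insert parentheses), and $\mathcal F_n$ is the set of full linear terms, obtained from bracketings by permuting the variables (each of $x_1,\dots,x_n$ occurs exactly once). Each such term $t$ induces an $n$-ary operation $t^*$ on $G$. The associative spectrum is $s_n(*):=|\{t^*:t\in\mathcal B_n\}|$ and the associative-commutative spectrum is $s^{ac}_n(*):=|\{t^*:t\in\mathcal F_n\}|$. A groupoid satisfies an identity if both sides take equal values under every assignment of elements of $G$ to the variables. A 3-element groupoid on $\{0,1,2\}$ is given by its Cayley table; "row $a{:}\ p\,q\,r$" means $a*0=p$, $a*1=q$, $a*2=r$. -}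

module Defs where

open import Level using (Level)
open import Data.Nat using (ℕ)
open import Data.Fin using (Fin; zero; suc)
open import Data.List using (List; []; _∷_; _++_; allFin)
open import Data.List.Relation.Binary.Permutation.Propositional using (_↭_)
open import Data.Product using (Σ; ∃; _×_; _,_; proj₁)
open import Relation.Binary.PropositionalEquality using (_≡_; _≢_)
open import Relation.Nullary using (¬_)

data Term (n : ℕ) : Set where
  var  : Fin n → Term n
  _·_  : Term n → Term n → Term n

leaves : ∀ {n} → Term n → List (Fin n)
leaves (var i) = i ∷ []
leaves (s · t) = leaves s ++ leaves t

Bracketing : ℕ → Set
Bracketing n = Σ (Term n) (λ t → leaves t ≡ allFin n)

FullLinear : ℕ → Set
FullLinear n = Σ (Term n) (λ t → leaves t ↭ allFin n)

⟦_⟧ : ∀ {ℓ} {G : Set ℓ} {n} → Term n → (G → G → G) → (Fin n → G) → G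
⟦ var i ⟧ _*_ ρ = ρ i
⟦ s · t ⟧ _*_ ρ = (⟦ s ⟧ _*_ ρ) * (⟦ t ⟧ _*_ ρ)

SameOp : ∀ {ℓ} {G : Set ℓ} {n} → (G → G → G) → Term n → Term n → Set ℓ
SameOp {n = n} _*_ s t = ∀ ρ → ⟦ s ⟧ _*_ ρ ≡ ⟦ t ⟧ _*_ ρ

-- |{ t* : t ∈ T }| ≤ k : there are k terms in T whose operations cover all t*.
SpecAtMost : ∀ {ℓ} {G : Set ℓ} {n} (_*_ : G → G → G)
             (T : Set) (term : T → Term n) (k : ℕ) → Set ℓ
SpecAtMost _*_ T term k =
  Σ (Fin k → T) λ w → ∀ t → ∃ λ i → SameOp _*_ (term t) (term (w i))

-- |{ t* : t ∈ T }| = k : there are k terms in T with pairwise distinct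
-- operations covering all t*.
SpecExactly : ∀ {ℓ} {G : Set ℓ} {n} (_*_ : G → G → G)
              (T : Set) (term : T → Term n) (k : ℕ) → Set ℓ
SpecExactly _*_ T term k =
  Σ (Fin k → T) λ w →
    (∀ i j → i ≢ j → ¬ SameOp _*_ (term (w i)) (term (w j)))
    × (∀ t → ∃ λ i → SameOp _*_ (term t) (term (w i)))

s≤ s= sac≤ sac= : ∀ {ℓ} {G : Set ℓ} → (G → G → G) → ℕ → ℕ → Set ℓ
s≤   _*_ n k = SpecAtMost  _*_ (Bracketing n) proj₁ k
s=   _*_ n k = SpecExactly _*_ (Bracketing n) proj₁ k
sac≤ _*_ n k = SpecAtMost  _*_ (FullLinear n) proj₁ k
sac= _*_ n k = SpecExactly _*_ (FullLinear n) proj₁ k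

SC7 : Fin 3 → Fin 3 → Fin 3
SC7 (suc (suc zero)) (suc zero) = suc (suc zero)
SC7 _ _ = zero

SC28 : Fin 3 → Fin 3 → Fin 3
SC28 zero _ = zero
SC28 (suc _) (suc (suc zero)) = suc zero
SC28 (suc _) _ = zero

-- By (i) the arguments after the first of a left comb (⋯((xᵢ x_{j₁}) x_{j₂})⋯) x_{jₘ} may be
-- permuted, so a left comb is determined by its first variable. Every other term has a subterm
-- p(qr); using (ii) and (iii) it evaluates like the right comb x_{k₁}(x_{k₂}(⋯)) of its leaves,
-- and by (ii) a right comb with at least three leaves is invariant under permuting them.
-- So the full linear terms induce at most the n left-comb operations and the right-comb one, and
-- the bracketings only ((x₁x₂)⋯)xₙ and x₁(x₂(⋯xₙ)); if there are n+1 operations, these two differ.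
-- In SC7 and SC28 every product x(yz) is 0, and there are a, b with ab = a, ya = 0 = 0y for all y;
-- giving xᵢ the value a and the other variables b, the left comb starting at xᵢ takes the value a
-- while every other left comb and the right comb take the value 0.

module Submission where

open import Defs
open import Data.Nat using (ℕ; zero; suc; _≤_; _+_; s≤s; z≤n)
open import Data.Nat.Properties using (+-comm; +-mono-≤; ≤-trans; n<1+n)
open import Data.Fin as Fin using (Fin; _≟_; #_; punchIn; punchOut)
open import Data.Fin.Properties using (all?; pigeonhole; <⇒≢; punchInᵢ≢i; punchIn-punchOut)
open import Data.List using (List; []; _∷_; _++_; _∷ʳ_; [_]; length; map; foldl; tabulate; allFin)
open import Data.List.Properties
  using (++-assoc; ++-identityʳ; map-++; length-map; length-++; length-++-≤ˡ; length-++-≤ʳ; map-tabulate)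
open import Data.List.Membership.Propositional using (_∈_)
open import Data.List.Membership.Propositional.Properties using (∈-tabulate⁺; ∈-map⁺)
open import Data.List.Relation.Unary.All as All using (All; []; _∷_)
open import Data.List.Relation.Unary.All.Properties using (tabulate⁺) renaming (map⁺ to All-map⁺)
open import Data.List.Relation.Unary.Any using (here; there)
open import Data.List.Relation.Binary.Permutation.Propositional as ↭
  using (_↭_; prep; swap; ↭-refl; ↭-sym; ↭-trans; ↭-reflexive; module PermutationReasoning)
open import Data.List.Relation.Binary.Permutation.Propositional.Properties
  using (↭-length; ↭-empty-inv; ¬x∷xs↭[]; shift; drop-∷; ∷↭∷ʳ; map⁺)
open import Data.Product using (∃; ∃₂; _×_; _,_; proj₁; proj₂)
open import Data.Empty using (⊥-elim)
open import Function using (_∘_; _∋_)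
open import Relation.Binary.PropositionalEquality
  using (_≡_; _≢_; refl; sym; trans; cong; cong₂; subst; module ≡-Reasoning)
open import Relation.Nullary using (¬_; yes; no)
open import Relation.Nullary.Decidable using (from-yes)

leftComb : ∀ {n} → Term n → List (Fin n) → Term n
leftComb t []      = t
leftComb t (j ∷ l) = leftComb (t · var j) l

rightComb : ∀ {n} → Fin n → List (Fin n) → Term n
rightComb i []      = var i
rightComb i (j ∷ l) = var i · rightComb j l

leftComb-∷ʳ : ∀ {n} (t : Term n) l j → leftComb t (l ∷ʳ j) ≡ leftComb t l · var j
leftComb-∷ʳ t []      j = refl
leftComb-∷ʳ t (k ∷ l) j = leftComb-∷ʳ (t · var k) l j

leaves-leftComb : ∀ {n} (t : Term n) l → leaves (leftComb t l) ≡ leaves t ++ l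
leaves-leftComb t []      = sym (++-identityʳ (leaves t))
leaves-leftComb t (j ∷ l) = trans (leaves-leftComb (t · var j) l) (++-assoc (leaves t) [ j ] l)

leaves-rightComb : ∀ {n} (i : Fin n) l → leaves (rightComb i l) ≡ i ∷ l
leaves-rightComb i []      = refl
leaves-rightComb i (j ∷ l) = cong (i ∷_) (leaves-rightComb j l)

1≤length-leaves : ∀ {n} (t : Term n) → 1 ≤ length (leaves t)
1≤length-leaves (var i) = s≤s z≤n
1≤length-leaves (s · t) = ≤-trans (1≤length-leaves s) (length-++-≤ˡ (leaves s))

3≤length-leaves : ∀ {n} (p q₁ q₂ : Term n) → 3 ≤ length (leaves (p · (q₁ · q₂)))
3≤length-leaves p q₁ q₂
  rewrite length-++ (leaves p) {leaves q₁ ++ leaves q₂} | length-++ (leaves q₁) {leaves q₂}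
  = +-mono-≤ (1≤length-leaves p) (+-mono-≤ (1≤length-leaves q₁) (1≤length-leaves q₂))

-- map ρ ∘ leaves, defined so that it splits definitionally along products.
values : ∀ {A : Set} {n} → (Fin n → A) → Term n → List A
values ρ (var i) = [ ρ i ]
values ρ (s · t) = values ρ s ++ values ρ t

values≡map-leaves : ∀ {A : Set} {n} (ρ : Fin n → A) t → values ρ t ≡ map ρ (leaves t)
values≡map-leaves ρ (var i) = refl
values≡map-leaves ρ (s · t) =
  trans (cong₂ _++_ (values≡map-leaves ρ s) (values≡map-leaves ρ t)) (sym (map-++ ρ (leaves s) (leaves t)))

length-values : ∀ {A : Set} {n} (ρ : Fin n → A) t → length (values ρ t) ≡ length (leaves t)
length-values ρ t = trans (cong length (values≡map-leaves ρ t)) (length-map ρ (leaves t))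

1≤length-values : ∀ {A : Set} {n} (ρ : Fin n → A) t → 1 ≤ length (values ρ t)
1≤length-values ρ t = subst (1 ≤_) (sym (length-values ρ t)) (1≤length-leaves t)

3≤length-values : ∀ {A : Set} {n} (ρ : Fin n → A) t → 3 ≤ length (leaves t) → 3 ≤ length (values ρ t)
3≤length-values ρ t = subst (3 ≤_) (sym (length-values ρ t))

values-↭ : ∀ {A : Set} {n} (ρ : Fin n → A) s t → leaves s ↭ leaves t → values ρ s ↭ values ρ t
values-↭ ρ s t p =
  ↭-trans (↭-reflexive (values≡map-leaves ρ s))
    (↭-trans (map⁺ ρ p) (↭-reflexive (sym (values≡map-leaves ρ t))))

values-∷ : ∀ {A : Set} {n} (ρ : Fin n → A) t → ∃₂ λ a l → values ρ t ≡ a ∷ l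
values-∷ ρ (var i) = ρ i , [] , refl
values-∷ ρ (s · t) with values-∷ ρ s
... | a , l , eq = a , l ++ values ρ t , cong (_++ values ρ t) eq

values-· : ∀ {A : Set} {n} (ρ : Fin n → A) s t → ∃₂ λ a b → ∃ λ l → values ρ (s · t) ≡ a ∷ b ∷ l
values-· ρ (var i) t with values-∷ ρ t
... | b , l , eq = ρ i , b , l , cong (ρ i ∷_) eq
values-· ρ (s₁ · s₂) t with values-· ρ s₁ s₂
... | a , b , l , eq = a , b , l ++ values ρ t , cong (_++ values ρ t) eq

others : ∀ {n} → Fin (suc n) → List (Fin (suc n))
others i = tabulate (punchIn i)

∷-others↭allFin : ∀ {n} (i : Fin (suc n)) → i ∷ others i ↭ allFin (suc n)
∷-others↭allFin Fin.zero = ↭-refl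
∷-others↭allFin {suc n} (Fin.suc i) = begin
  Fin.suc i ∷ Fin.zero ∷ tabulate (Fin.suc ∘ punchIn i)
    ↭⟨ swap _ _ ↭-refl ⟩
  Fin.zero ∷ Fin.suc i ∷ tabulate (Fin.suc ∘ punchIn i)
    ≡⟨ cong (λ l → Fin.zero ∷ Fin.suc i ∷ l) (map-tabulate (punchIn i) Fin.suc) ⟨
  Fin.zero ∷ map Fin.suc (i ∷ others i)
    ↭⟨ prep Fin.zero (map⁺ Fin.suc (∷-others↭allFin i)) ⟩
  Fin.zero ∷ map Fin.suc (allFin (suc n))
    ≡⟨ cong (Fin.zero ∷_) (map-tabulate (λ j → j) Fin.suc) ⟩
  allFin (suc (suc n))
    ∎
  where open PermutationReasoning

others-≢ : ∀ {n} (i : Fin (suc n)) → All (_≢ i) (others i)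
others-≢ i = tabulate⁺ (punchInᵢ≢i i)

∈-others : ∀ {n} {i j : Fin (suc n)} → i ≢ j → j ∈ others i
∈-others i≢j = subst (_∈ others _) (punchIn-punchOut i≢j) (∈-tabulate⁺ (punchOut i≢j))

module Groupoid {G : Set} (_*_ : G → G → G) where

  -- rightFold d [a₁, …, aₘ] = a₁(a₂(⋯aₘ)); the junk value d is returned only for [].
  rightFold : G → List G → G
  rightFold d []          = d
  rightFold d (a ∷ [])    = a
  rightFold d (a ∷ b ∷ l) = a * rightFold d (b ∷ l)

  rightFold-∷ : ∀ d a l → 1 ≤ length l → rightFold d (a ∷ l) ≡ a * rightFold d l
  rightFold-∷ d a (_ ∷ _) _ = refl

  ⟦⟧-leftComb : ∀ {n} (ρ : Fin n → G) t l → ⟦ leftComb t l ⟧ _*_ ρ ≡ foldl _*_ (⟦ t ⟧ _*_ ρ) (map ρ l)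
  ⟦⟧-leftComb ρ t []      = refl
  ⟦⟧-leftComb ρ t (j ∷ l) = ⟦⟧-leftComb ρ (t · var j) l

  IsFlat : ∀ {n} → Term n → Set
  IsFlat t = ∀ d ρ → ⟦ t ⟧ _*_ ρ ≡ rightFold d (values ρ t)

  rightComb-isFlat : ∀ {n} (i : Fin n) l → IsFlat (rightComb i l)
  rightComb-isFlat i []      d ρ = refl
  rightComb-isFlat i (j ∷ l) d ρ = begin
    ρ i * ⟦ rightComb j l ⟧ _*_ ρ  ≡⟨ cong (ρ i *_) (rightComb-isFlat j l d ρ) ⟩
    ρ i * rightFold d vs           ≡⟨ rightFold-∷ d (ρ i) vs (1≤length-values ρ (rightComb j l)) ⟨
    rightFold d (ρ i ∷ vs)         ∎
    where
    open ≡-Reasoning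
    vs = values ρ (rightComb j l)

  foldl-fixed : ∀ {x} l → All (λ y → x * y ≡ x) l → foldl _*_ x l ≡ x
  foldl-fixed []      []            = refl
  foldl-fixed (y ∷ l) (x*y≡x ∷ fix) = trans (cong (λ x → foldl _*_ x l) x*y≡x) (foldl-fixed l fix)

  foldl-leftZero : ∀ {o} → (∀ y → o * y ≡ o) → ∀ l → foldl _*_ o l ≡ o
  foldl-leftZero o*y≡o []      = refl
  foldl-leftZero o*y≡o (y ∷ l) = trans (cong (λ x → foldl _*_ x l) (o*y≡o y)) (foldl-leftZero o*y≡o l)

  foldl-absorbed : ∀ {o z} → (∀ y → o * y ≡ o) → (∀ y → y * z ≡ o) → ∀ x {l} → z ∈ l → foldl _*_ x l ≡ o
  foldl-absorbed o*y≡o y*z≡o x {_ ∷ l} (here refl) =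
    trans (cong (λ x → foldl _*_ x l) (y*z≡o x)) (foldl-leftZero o*y≡o l)
  foldl-absorbed o*y≡o y*z≡o x {y ∷ _} (there z∈l) = foldl-absorbed o*y≡o y*z≡o (x * y) z∈l

module Identities {G : Set} (_*_ : G → G → G)
  (rightComm  : ∀ x y z → (x * y) * z ≡ (x * z) * y)
  (innerComm  : ∀ x y z → x * (y * z) ≡ x * (z * y))
  (leftComm   : ∀ x y z → x * (y * z) ≡ y * (x * z))
  (innerAssoc : ∀ w x y z → w * (x * (y * z)) ≡ w * ((x * y) * z))
  where

  open Groupoid _*_
  open ≡-Reasoning

  foldl-↭ : ∀ x {l l′} → l ↭ l′ → foldl _*_ x l ≡ foldl _*_ x l′
  foldl-↭ x ↭.refl            = refl
  foldl-↭ x (prep y p)        = foldl-↭ (x * y) p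
  foldl-↭ x (swap {xs} y z p) = trans (cong (λ u → foldl _*_ u xs) (rightComm x y z)) (foldl-↭ ((x * z) * y) p)
  foldl-↭ x (↭.trans p q)     = trans (foldl-↭ x p) (foldl-↭ x q)

  leftComb-↭ : ∀ {n} (i : Fin n) {l l′} → l ↭ l′ → SameOp _*_ (leftComb (var i) l) (leftComb (var i) l′)
  leftComb-↭ i {l} {l′} p ρ = begin
    ⟦ leftComb (var i) l ⟧ _*_ ρ   ≡⟨ ⟦⟧-leftComb ρ (var i) l ⟩
    foldl _*_ (ρ i) (map ρ l)      ≡⟨ foldl-↭ (ρ i) (map⁺ ρ p) ⟩
    foldl _*_ (ρ i) (map ρ l′)     ≡⟨ ⟦⟧-leftComb ρ (var i) l′ ⟨
    ⟦ leftComb (var i) l′ ⟧ _*_ ρ  ∎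

  module _ (d : G) where

    rightFold-prep : ∀ x {xs ys} → xs ↭ ys → x * rightFold d xs ≡ x * rightFold d ys →
                     rightFold d (x ∷ xs) ≡ rightFold d (x ∷ ys)
    rightFold-prep x {[]}    p _ with refl ← ↭-empty-inv (↭-sym p) = refl
    rightFold-prep x {_ ∷ _} {[]}    p _   = ⊥-elim (¬x∷xs↭[] p)
    rightFold-prep x {_ ∷ _} {_ ∷ _} _ x*≡ = x*≡

    rightFold-swap : ∀ x y {a xs ys} → a ∷ xs ↭ ys → x * rightFold d (a ∷ xs) ≡ x * rightFold d ys →
                     rightFold d (x ∷ y ∷ a ∷ xs) ≡ rightFold d (y ∷ x ∷ ys)
    rightFold-swap x y {ys = []}             p _   = ⊥-elim (¬x∷xs↭[] p)
    rightFold-swap x y {a} {xs} {ys = _ ∷ _} _ x*≡ =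
      trans (leftComm x y (rightFold d (a ∷ xs))) (cong (y *_) x*≡)

    -- Under a left factor, innerComm swaps the two innermost entries and leftComm any two others.
    *-rightFold-↭ : ∀ w {xs ys} → xs ↭ ys → w * rightFold d xs ≡ w * rightFold d ys
    *-rightFold-↭ w ↭.refl                    = refl
    *-rightFold-↭ w (prep x p)                = cong (w *_) (rightFold-prep x p (*-rightFold-↭ x p))
    *-rightFold-↭ w (swap {xs = []} x y p) with refl ← ↭-empty-inv (↭-sym p) = innerComm w x y
    *-rightFold-↭ w (swap {xs = _ ∷ _} x y p) = cong (w *_) (rightFold-swap x y p (*-rightFold-↭ x p))
    *-rightFold-↭ w (↭.trans p q)             = trans (*-rightFold-↭ w p) (*-rightFold-↭ w q)

    rightFold-↭ : ∀ {xs ys} → xs ↭ ys → 3 ≤ length xs → rightFold d xs ≡ rightFold d ys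
    rightFold-↭ ↭.refl                    _  = refl
    rightFold-↭ (prep x p)                _  = rightFold-prep x p (*-rightFold-↭ x p)
    rightFold-↭ (swap {xs = []} x y p)    (s≤s (s≤s ()))
    rightFold-↭ (swap {xs = _ ∷ _} x y p) _  = rightFold-swap x y p (*-rightFold-↭ x p)
    rightFold-↭ (↭.trans p q)             3≤ =
      trans (rightFold-↭ p 3≤) (rightFold-↭ q (subst (3 ≤_) (↭-length p) 3≤))

    rightFold-∷ʳ : ∀ xs b → 3 ≤ length xs → rightFold d xs * b ≡ rightFold d (xs ∷ʳ b)
    rightFold-∷ʳ (x ∷ y ∷ z ∷ l) b _ = begin
      (x * (y * R)) * b                ≡⟨ rightComm x (y * R) b ⟩
      (x * b) * (y * R)                ≡⟨ leftComm (x * b) y R ⟩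
      y * ((x * b) * R)                ≡⟨ innerAssoc y x b R ⟨
      y * (x * (b * R))                ≡⟨ rightFold-↭ (swap y x (∷↭∷ʳ b (z ∷ l))) (s≤s (s≤s (s≤s z≤n))) ⟩
      rightFold d (x ∷ y ∷ z ∷ l ∷ʳ b) ∎
      where R = rightFold d (z ∷ l)
    rightFold-∷ʳ (_ ∷ [])     _ (s≤s ())
    rightFold-∷ʳ (_ ∷ _ ∷ []) _ (s≤s (s≤s ()))

    module _ {n} (ρ : Fin n → G) where

      *-flatten-· : ∀ p w l → 1 ≤ length l →
                    w * (⟦ p ⟧ _*_ ρ * rightFold d l) ≡ w * rightFold d (values ρ p ++ l)
      *-flatten-· (var i)   w l 1≤ = cong (w *_) (sym (rightFold-∷ d (ρ i) l 1≤))
      *-flatten-· (p₁ · p₂) w l 1≤ = begin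
        w * ((P₁ * P₂) * rightFold d l)        ≡⟨ innerAssoc w P₁ P₂ (rightFold d l) ⟨
        w * (P₁ * (P₂ * rightFold d l))        ≡⟨ leftComm w P₁ _ ⟩
        P₁ * (w * (P₂ * rightFold d l))        ≡⟨ cong (P₁ *_) (*-flatten-· p₂ w l 1≤) ⟩
        P₁ * (w * rightFold d (vs₂ ++ l))      ≡⟨ leftComm P₁ w _ ⟩
        w * (P₁ * rightFold d (vs₂ ++ l))      ≡⟨ *-flatten-· p₁ w (vs₂ ++ l) (≤-trans 1≤ (length-++-≤ʳ l {vs₂})) ⟩
        w * rightFold d (vs₁ ++ vs₂ ++ l)      ≡⟨ cong (λ vs → w * rightFold d vs) (++-assoc vs₁ vs₂ l) ⟨
        w * rightFold d ((vs₁ ++ vs₂) ++ l)    ∎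
        where
        P₁ = ⟦ p₁ ⟧ _*_ ρ
        P₂ = ⟦ p₂ ⟧ _*_ ρ
        vs₁ = values ρ p₁
        vs₂ = values ρ p₂

      *-flatten : ∀ u w → w * ⟦ u ⟧ _*_ ρ ≡ w * rightFold d (values ρ u)
      *-flatten (var i) w = refl
      *-flatten (p · q) w = begin
        w * (P * Q)                          ≡⟨ leftComm w P Q ⟩
        P * (w * Q)                          ≡⟨ cong (P *_) (*-flatten q w) ⟩
        P * (w * rightFold d (values ρ q))   ≡⟨ leftComm P w _ ⟩
        w * (P * rightFold d (values ρ q))   ≡⟨ *-flatten-· p w (values ρ q) (1≤length-values ρ q) ⟩
        w * rightFold d (values ρ (p · q))   ∎
        where
        P = ⟦ p ⟧ _*_ ρ
        Q = ⟦ q ⟧ _*_ ρ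

      ·-flatten : ∀ p q₁ q₂ → ⟦ p · (q₁ · q₂) ⟧ _*_ ρ ≡ rightFold d (values ρ (p · (q₁ · q₂)))
      ·-flatten p q₁ q₂ with values-· ρ q₁ q₂
      ... | a , b , l , vs-q≡ = begin
        P * ⟦ q₁ · q₂ ⟧ _*_ ρ                  ≡⟨ *-flatten (q₁ · q₂) P ⟩
        P * rightFold d (values ρ (q₁ · q₂))   ≡⟨ cong (λ vs → P * rightFold d vs) vs-q≡ ⟩
        P * (a * rightFold d (b ∷ l))          ≡⟨ leftComm P a _ ⟩
        a * (P * rightFold d (b ∷ l))          ≡⟨ *-flatten-· p a (b ∷ l) (s≤s z≤n) ⟩
        a * rightFold d (vs ++ b ∷ l)          ≡⟨ rightFold-∷ d a (vs ++ b ∷ l) 1≤ ⟨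
        rightFold d (a ∷ vs ++ b ∷ l)          ≡⟨ rightFold-↭ (↭-sym (shift a vs (b ∷ l))) 3≤ ⟩
        rightFold d (vs ++ a ∷ b ∷ l)          ≡⟨ cong (λ vs′ → rightFold d (vs ++ vs′)) vs-q≡ ⟨
        rightFold d (vs ++ values ρ (q₁ · q₂))  ∎
        where
        P = ⟦ p ⟧ _*_ ρ
        vs = values ρ p
        1≤ : 1 ≤ length (vs ++ b ∷ l)
        1≤ = ≤-trans (s≤s z≤n) (length-++-≤ʳ (b ∷ l) {vs})
        3≤ : 3 ≤ length (a ∷ vs ++ b ∷ l)
        3≤ = s≤s (subst (2 ≤_) (sym (length-++ vs)) (+-mono-≤ (1≤length-values ρ p) (s≤s z≤n)))

  data Shape {n} (t : Term n) : Set where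
    isLeftComb : ∀ i l → t ≡ leftComb (var i) l → Shape t
    isFlat     : 3 ≤ length (leaves t) → IsFlat t → Shape t

  shape : ∀ {n} (t : Term n) → Shape t
  shape (var i) = isLeftComb i [] refl
  shape (p · var j) with shape p
  ... | isLeftComb i l refl = isLeftComb i (l ∷ʳ j) (sym (leftComb-∷ʳ (var i) l j))
  ... | isFlat 3≤ p-flat    = isFlat (≤-trans 3≤ (length-++-≤ˡ (leaves p))) λ d ρ →
    trans (cong (_* ρ j) (p-flat d ρ)) (rightFold-∷ʳ d (values ρ p) (ρ j) (3≤length-values ρ p 3≤))
  shape (p · (q₁ · q₂)) = isFlat (3≤length-leaves p q₁ q₂) (λ d ρ → ·-flatten d ρ p q₁ q₂)

  flat-↭ : ∀ {n} (s t : Term n) → leaves s ↭ leaves t → 3 ≤ length (leaves s) →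
           IsFlat s → IsFlat t → SameOp _*_ s t
  flat-↭ s t s↭t 3≤ s-flat t-flat ρ = begin
    ⟦ s ⟧ _*_ ρ               ≡⟨ s-flat d ρ ⟩
    rightFold d (values ρ s)  ≡⟨ rightFold-↭ d (values-↭ ρ s t s↭t) (3≤length-values ρ s 3≤) ⟩
    rightFold d (values ρ t)  ≡⟨ t-flat d ρ ⟨
    ⟦ t ⟧ _*_ ρ               ∎
    where d = ⟦ s ⟧ _*_ ρ

  module Spectrum (n : ℕ) where

    rightmost leftmost : Term (suc n)
    rightmost = rightComb Fin.zero (tabulate Fin.suc)
    leftmost  = leftComb (var Fin.zero) (tabulate Fin.suc)

    leftCombAt : Fin (suc n) → Term (suc n)
    leftCombAt i = leftComb (var i) (others i)

    leaves-leftCombAt : ∀ i → leaves (leftCombAt i) ↭ allFin (suc n)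
    leaves-leftCombAt i = ↭-trans (↭-reflexive (leaves-leftComb (var i) (others i))) (∷-others↭allFin i)

    leftComb≈leftCombAt : ∀ i l → leaves (leftComb (var i) l) ↭ allFin (suc n) →
                          SameOp _*_ (leftComb (var i) l) (leftCombAt i)
    leftComb≈leftCombAt i l l↭ = leftComb-↭ i (drop-∷ i∷l↭i∷others)
      where
      i∷l↭i∷others : i ∷ l ↭ i ∷ others i
      i∷l↭i∷others = ↭-trans (↭-reflexive (sym (leaves-leftComb (var i) l)))
                       (↭-trans l↭ (↭-sym (∷-others↭allFin i)))

    leaves-rightmost : leaves rightmost ≡ allFin (suc n)
    leaves-rightmost = leaves-rightComb Fin.zero (tabulate Fin.suc)

    flat≈rightmost : ∀ t → leaves t ↭ allFin (suc n) → 3 ≤ length (leaves t) → IsFlat t →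
                     SameOp _*_ t rightmost
    flat≈rightmost t t↭ 3≤ t-flat =
      flat-↭ t rightmost (↭-trans t↭ (↭-reflexive (sym leaves-rightmost))) 3≤ t-flat
        (rightComb-isFlat Fin.zero (tabulate Fin.suc))

    representative : Fin (suc (suc n)) → FullLinear (suc n)
    representative Fin.zero    = rightmost , ↭-reflexive leaves-rightmost
    representative (Fin.suc i) = leftCombAt i , leaves-leftCombAt i

    representative-covers : ∀ t → ∃ λ k → SameOp _*_ (proj₁ t) (proj₁ (representative k))
    representative-covers (t , t↭) with shape t
    ... | isLeftComb i l refl = Fin.suc i , leftComb≈leftCombAt i l t↭
    ... | isFlat 3≤ t-flat    = Fin.zero , flat≈rightmost t t↭ 3≤ t-flat

    sac≤2+n : sac≤ _*_ (suc n) (suc (suc n))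
    sac≤2+n = representative , representative-covers

    bracketing : Fin 2 → Bracketing (suc n)
    bracketing Fin.zero    = leftmost , leaves-leftComb (var Fin.zero) (tabulate Fin.suc)
    bracketing (Fin.suc _) = rightmost , leaves-rightmost

    bracketing-covers : ∀ t → ∃ λ k → SameOp _*_ (proj₁ t) (proj₁ (bracketing k))
    bracketing-covers (t , t≡) with shape t
    ... | isFlat 3≤ t-flat    = Fin.suc Fin.zero , flat≈rightmost t (↭-reflexive t≡) 3≤ t-flat
    ... | isLeftComb i l refl
      with (i ∷ l ≡ Fin.zero ∷ tabulate Fin.suc) ∋ trans (sym (leaves-leftComb (var i) l)) t≡
    ...   | refl = Fin.zero , λ _ → refl

    s≤2 : s≤ _*_ (suc n) 2
    s≤2 = bracketing , bracketing-covers

    s=2 : ¬ SameOp _*_ leftmost rightmost → s= _*_ (suc n) 2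
    s=2 l≉r = bracketing , distinct , bracketing-covers
      where
      distinct : ∀ k m → k ≢ m → ¬ SameOp _*_ (proj₁ (bracketing k)) (proj₁ (bracketing m))
      distinct Fin.zero           Fin.zero           k≢m _   = k≢m refl
      distinct Fin.zero           (Fin.suc Fin.zero) _   l≈r = l≉r l≈r
      distinct (Fin.suc Fin.zero) Fin.zero           _   r≈l = l≉r λ ρ → sym (r≈l ρ)
      distinct (Fin.suc Fin.zero) (Fin.suc Fin.zero) k≢m _   = k≢m refl

    leftmost≈rightmost⇒≈leftCombAt : SameOp _*_ leftmost rightmost →
                                     ∀ t → ∃ λ i → SameOp _*_ (proj₁ t) (leftCombAt i)
    leftmost≈rightmost⇒≈leftCombAt l≈r t with representative-covers t
    ... | Fin.suc i , t≈ = i , t≈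
    ... | Fin.zero  , t≈r = Fin.zero , λ ρ → trans (t≈r ρ) (trans (sym (l≈r ρ)) (l≈leftCombAt ρ))
      where
      l≈leftCombAt : SameOp _*_ leftmost (leftCombAt Fin.zero)
      l≈leftCombAt = leftComb≈leftCombAt Fin.zero (tabulate Fin.suc) (↭-reflexive (proj₂ (bracketing Fin.zero)))

    -- Otherwise the 1+n left combs would represent all 2+n distinct operations.
    sac=2+n⇒leftmost≉rightmost : sac= _*_ (suc n) (suc (suc n)) → ¬ SameOp _*_ leftmost rightmost
    sac=2+n⇒leftmost≉rightmost (w , distinct , _) l≈r
      with pigeonhole (n<1+n (suc n)) (proj₁ ∘ leftmost≈rightmost⇒≈leftCombAt l≈r ∘ w)
    ... | k , m , k<m , same = distinct k m (<⇒≢ k<m) λ ρ → begin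
      ⟦ proj₁ (w k) ⟧ _*_ ρ                   ≡⟨ proj₂ (class k) ρ ⟩
      ⟦ leftCombAt (proj₁ (class k)) ⟧ _*_ ρ  ≡⟨ cong (λ i → ⟦ leftCombAt i ⟧ _*_ ρ) same ⟩
      ⟦ leftCombAt (proj₁ (class m)) ⟧ _*_ ρ  ≡⟨ proj₂ (class m) ρ ⟨
      ⟦ proj₁ (w m) ⟧ _*_ ρ                   ∎
      where class = leftmost≈rightmost⇒≈leftCombAt l≈r ∘ w

    sac=2+n-by-separation : (σ : Fin (suc n) → Fin (suc n) → G) {o a : G} → a ≢ o →
      (∀ i → ⟦ rightmost ⟧ _*_ (σ i) ≡ o) →
      (∀ i → ⟦ leftCombAt i ⟧ _*_ (σ i) ≡ a) →
      (∀ i j → i ≢ j → ⟦ leftCombAt j ⟧ _*_ (σ i) ≡ o) →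
      sac= _*_ (suc n) (suc (suc n))
    sac=2+n-by-separation σ {o} {a} a≢o rightmost≡o own≡a other≡o =
      representative , distinct , representative-covers
      where
      distinct : ∀ k m → k ≢ m → ¬ SameOp _*_ (proj₁ (representative k)) (proj₁ (representative m))
      distinct Fin.zero    Fin.zero    k≢m _   = k≢m refl
      distinct Fin.zero    (Fin.suc i) _   r≈i =
        a≢o (trans (sym (own≡a i)) (trans (sym (r≈i (σ i))) (rightmost≡o i)))
      distinct (Fin.suc i) Fin.zero    _   i≈r =
        a≢o (trans (sym (own≡a i)) (trans (i≈r (σ i)) (rightmost≡o i)))
      distinct (Fin.suc i) (Fin.suc j) k≢m i≈j =
        a≢o (trans (sym (own≡a i)) (trans (i≈j (σ i)) (other≡o i j (k≢m ∘ cong Fin.suc))))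

  spectrum-bounds : ∀ n → 1 ≤ n → s≤ _*_ n 2 × sac≤ _*_ n (n + 1) × (sac= _*_ n (n + 1) → s= _*_ n 2)
  spectrum-bounds (suc n) _ =
    s≤2 , subst (sac≤ _*_ (suc n)) 2+n≡ sac≤2+n ,
    s=2 ∘ sac=2+n⇒leftmost≉rightmost ∘ subst (sac= _*_ (suc n)) (sym 2+n≡)
    where
    open Spectrum n
    2+n≡ : suc (suc n) ≡ suc n + 1
    2+n≡ = +-comm 1 (suc n)

module Example {G : Set} (_*_ : G → G → G)
  (rightComm : ∀ x y z → (x * y) * z ≡ (x * z) * y)
  {o a b : G} (a≢o : a ≢ o)
  (x*[y*z]≡o : ∀ x y z → x * (y * z) ≡ o)
  (o*y≡o : ∀ y → o * y ≡ o) (y*a≡o : ∀ y → y * a ≡ o) (a*b≡a : a * b ≡ a)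
  where

  open Groupoid _*_
  open Identities _*_ rightComm
    (λ x y z → trans (x*[y*z]≡o x y z) (sym (x*[y*z]≡o x z y)))
    (λ x y z → trans (x*[y*z]≡o x y z) (sym (x*[y*z]≡o y x z)))
    (λ w x y z → trans (x*[y*z]≡o w x (y * z)) (sym (x*[y*z]≡o w (x * y) z)))

  marked : ∀ {m} → Fin m → Fin m → G
  marked i j with j ≟ i
  ... | yes _ = a
  ... | no  _ = b

  marked-≡ : ∀ {m} (i : Fin m) → marked i i ≡ a
  marked-≡ i with i ≟ i
  ... | yes _  = refl
  ... | no i≢i = ⊥-elim (i≢i refl)

  marked-≢ : ∀ {m} {i j : Fin m} → j ≢ i → marked i j ≡ b
  marked-≢ {i = i} {j} j≢i with j ≟ i
  ... | yes j≡i = ⊥-elim (j≢i j≡i)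
  ... | no  _   = refl

  module _ (n : ℕ) where
    open Spectrum (suc (suc n))

    leftCombAt-marked-own : ∀ i → ⟦ leftCombAt i ⟧ _*_ (marked i) ≡ a
    leftCombAt-marked-own i = begin
      ⟦ leftCombAt i ⟧ _*_ (marked i)  ≡⟨ ⟦⟧-leftComb (marked i) (var i) (others i) ⟩
      foldl _*_ (marked i i) ms        ≡⟨ cong (λ x → foldl _*_ x ms) (marked-≡ i) ⟩
      foldl _*_ a ms                   ≡⟨ foldl-fixed ms (All-map⁺ (All.map a*marked≡a (others-≢ i))) ⟩
      a                                ∎
      where
      open ≡-Reasoning
      ms = map (marked i) (others i)
      a*marked≡a : ∀ {j} → j ≢ i → a * marked i j ≡ a
      a*marked≡a j≢i = trans (cong (a *_) (marked-≢ j≢i)) a*b≡a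

    leftCombAt-marked-other : ∀ i j → i ≢ j → ⟦ leftCombAt j ⟧ _*_ (marked i) ≡ o
    leftCombAt-marked-other i j i≢j = trans (⟦⟧-leftComb (marked i) (var j) (others j))
      (foldl-absorbed o*y≡o y*a≡o (marked i j) a∈)
      where
      a∈ : a ∈ map (marked i) (others j)
      a∈ = subst (_∈ map (marked i) (others j)) (marked-≡ i) (∈-map⁺ (marked i) (∈-others (i≢j ∘ sym)))

    sac=3+n : sac= _*_ (3 + n) (4 + n)
    sac=3+n = sac=2+n-by-separation marked a≢o (λ i → x*[y*z]≡o _ _ _)
      leftCombAt-marked-own leftCombAt-marked-other

  spectra : ∀ n → 3 ≤ n → s= _*_ n 2 × sac= _*_ n (n + 1)
  spectra (suc (suc (suc n))) _ =
    s=2 (sac=2+n⇒leftmost≉rightmost (sac=3+n n)) , subst (sac= _*_ (3 + n)) (+-comm 1 (3 + n)) (sac=3+n n)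
    where open Spectrum (suc (suc n))
  spectra (suc zero)       (s≤s ())
  spectra (suc (suc zero)) (s≤s (s≤s ()))

module SC7-Example = Example SC7
  (from-yes (all? λ x → all? λ y → all? λ z → SC7 (SC7 x y) z ≟ SC7 (SC7 x z) y))
  {o = # 0} {a = # 2} {b = # 1} (λ ())
  (from-yes (all? λ x → all? λ y → all? λ z → SC7 x (SC7 y z) ≟ # 0))
  (λ _ → refl) (from-yes (all? λ y → SC7 y (# 2) ≟ # 0)) refl

module SC28-Example = Example SC28
  (from-yes (all? λ x → all? λ y → all? λ z → SC28 (SC28 x y) z ≟ SC28 (SC28 x z) y))
  {o = # 0} {a = # 1} {b = # 2} (λ ())
  (from-yes (all? λ x → all? λ y → all? λ z → SC28 x (SC28 y z) ≟ # 0))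
  (λ _ → refl) (from-yes (all? λ y → SC28 y (# 1) ≟ # 0)) refl

proposition3p2 :
    (∀ (G : Set) (_*_ : G → G → G) →
       (∀ x y z → ((x * y) * z) ≡ ((x * z) * y)) →
       (∀ x y z → (x * (y * z)) ≡ (x * (z * y))) →
       (∀ x y z → (x * (y * z)) ≡ (y * (x * z))) →
       (∀ w x y z → (w * (x * (y * z))) ≡ (w * ((x * y) * z))) →
       ∀ n → 3 ≤ n →
         s≤ _*_ n 2 × sac≤ _*_ n (n + 1) × (sac= _*_ n (n + 1) → s= _*_ n 2))
    × (∀ n → 3 ≤ n →
         (s= SC7 n 2 × sac= SC7 n (n + 1)) × (s= SC28 n 2 × sac= SC28 n (n + 1)))
proposition3p2 =
  (λ G _*_ rightComm innerComm leftComm innerAssoc n 3≤n →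
     Identities.spectrum-bounds _*_ rightComm innerComm leftComm innerAssoc n (≤-trans (s≤s z≤n) 3≤n)) ,
  (λ n 3≤n → SC7-Example.spectra n 3≤n , SC28-Example.spectra n 3≤n)
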